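{- Let $H$ be the graph obtained from a graph $G$ by subdividing an edge. Then $\mathrm{T}(G)=\mathrm{T}(H)$.
   Context: All graphs are finite, simple and undirected. The tree cover number $\mathrm{T}(G)$ is the minimum number of vertex-disjoint induced trees of $G$ whose vertex sets cover $V(G)$. Subdividing an edge $uv$ means deleting $uv$, adding a new vertex $w$, and adding the edges $uw$ and $wv$. -}

module Defs where

open import Data.Nat using (ℕ; suc; _≤_; _<_)
open import Data.Fin using (Fin; zero; suc; _≟_)
open import Data.Bool using (Bool; true; false; _∧_; _∨_; not)
open import Data.Bool.Properties using (∧-comm; ∨-comm)
open import Data.List using (List; []; _∷_; _++_; length)
open import Data.List.Relation.Unary.All using (All)
open import Data.List.Relation.Unary.Unique.Propositional using (Unique)
open import Data.List.Relation.Unary.Linked using (Linked)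
open import Data.Product using (Σ; _×_; _,_; ∃)
open import Relation.Nullary using (¬_; yes; no)
open import Data.Empty using (⊥-elim)
open import Relation.Nullary.Decidable using (⌊_⌋)
open import Relation.Binary.PropositionalEquality using (_≡_; refl; cong₂; sym; trans)
open import Function.Bundles using (_⇔_)

record Graph : Set where
  field
    n      : ℕ
    adj    : Fin n → Fin n → Bool
    symm   : ∀ a b → adj a b ≡ adj b a
    irrefl : ∀ a → adj a a ≡ false

module _ (G : Graph) where
  open Graph G

  Adj : Fin n → Fin n → Set
  Adj a b = adj a b ≡ true

  -- Walks in the subgraph induced by the vertex set P.
  data Walk (P : Fin n → Set) : Fin n → Fin n → Set where
    here : ∀ {u} → P u → Walk P u u
    step : ∀ {u v w} → P u → Adj u v → Walk P v w → Walk P u w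

  Connected : (Fin n → Set) → Set
  Connected P = ∀ u v → P u → P v → Walk P u v

  -- A cycle in G[P]: distinct vertices x, x₁, ..., x_l (l ≥ 2, so at
  -- least 3 vertices) with consecutive ones adjacent and x_l adjacent to x.
  record Cycle (P : Fin n → Set) : Set where
    field
      x      : Fin n
      xs     : List (Fin n)
      long   : 2 ≤ length xs
      inP    : All P (x ∷ xs)
      unique : Unique (x ∷ xs)
      closed : Linked Adj (x ∷ xs ++ x ∷ [])

  IsInducedTree : (Fin n → Set) → Set
  IsInducedTree P = (∃ λ v → P v) × Connected P × ¬ Cycle P

  -- V(G) is partitioned into k vertex-disjoint induced trees
  -- (the classes of c, each nonempty).
  HasTreeCover : ℕ → Set
  HasTreeCover k = Σ (Fin n → Fin k) λ c → ∀ i → IsInducedTree (λ v → c v ≡ i)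

  IsTreeCoverNumber : ℕ → Set
  IsTreeCoverNumber k = HasTreeCover k × (∀ m → HasTreeCover m → k ≤ m)

-- Subdividing the edge uv of G: the new vertex w is `zero`, old vertex a
-- becomes `suc a`.
module _ (G : Graph) (u v : Fin (Graph.n G)) where
  open Graph G

  eq : Fin n → Fin n → Bool
  eq a b = ⌊ a ≟ b ⌋

  eq-sym : ∀ a b → eq a b ≡ eq b a
  eq-sym a b with a ≟ b | b ≟ a
  ... | yes _ | yes _ = refl
  ... | no _  | no _  = refl
  ... | yes p | no q  = ⊥-elim (q (sym p))
  ... | no q  | yes p = ⊥-elim (q (sym p))

  endpoint : Fin n → Bool
  endpoint a = eq a u ∨ eq a v

  isUV : Fin n → Fin n → Bool
  isUV a b = (eq a u ∧ eq b v) ∨ (eq a v ∧ eq b u)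

  isUV-sym : ∀ a b → isUV a b ≡ isUV b a
  isUV-sym a b with eq a u | eq a v | eq b u | eq b v
  ... | p | q | r | s = trans (∨-comm (p ∧ s) (q ∧ r)) (cong₂ _∨_ (∧-comm q r) (∧-comm p s))

  adjS : Fin (suc n) → Fin (suc n) → Bool
  adjS zero    zero    = false
  adjS zero    (suc b) = endpoint b
  adjS (suc a) zero    = endpoint a
  adjS (suc a) (suc b) = adj a b ∧ not (isUV a b)

  adjS-sym : ∀ a b → adjS a b ≡ adjS b a
  adjS-sym zero zero = refl
  adjS-sym zero (suc b) = refl
  adjS-sym (suc a) zero = refl
  adjS-sym (suc a) (suc b) = cong₂ (λ x y → x ∧ not y) (symm a b) (isUV-sym a b)

  adjS-irrefl : ∀ a → adjS a a ≡ false
  adjS-irrefl zero = refl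
  adjS-irrefl (suc a) rewrite irrefl a = refl

  subdivide : Adj G u v → Graph
  subdivide _ = record { n = suc n ; adj = adjS ; symm = adjS-sym ; irrefl = adjS-irrefl }

module Submission where

-- Let H be G with the edge uv replaced by the path u–w–v (w is vertex
-- zero of H, the old vertex a is suc a).  Both inequalities are proved by
-- transporting tree covers.
--   T(H) ≤ T(G): colour w like u.  A class avoiding w and not containing
--     both u and v induces the same subgraph in G and H; the class of u
--     gains w, which either subdivides its edge uv or hangs off u.
--   T(G) ≤ T(H): if w shares its class with u or v, delete w (the inverse
--     operation).  Otherwise the class of w is {w}.  If u, v lie in
--     different classes, drop the class {w}.  If they lie in one class R,
--     adding the edge uv to the tree H[R] closes a cycle; split R into the
--     part reachable from u without passing v and the rest, and give the
--     first part the now unused colour of w.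

open import Defs
open import Data.Nat using (ℕ; _≤_; z≤n; s≤s)
import Data.Nat as Nat
open import Data.Nat.Properties using (≤-refl; ≤-trans; ≤-antisym; n≤1+n)
open import Data.Fin using (Fin; zero; suc; _≟_; punchIn; punchOut)
open import Data.Fin.Properties using (suc-injective; any?; punchIn-punchOut; punchInᵢ≢i; punchIn-injective)
open import Data.Fin.Subset using (Subset; _⊂_; _-_; ⁅_⁆) renaming (_∈_ to _∈ₛ_)
open import Data.Fin.Subset.Properties using (p─q⊆p; x∈p⇒p-x⊂p; x∈p∧x≢y⇒x∈p-y) renaming (_∈?_ to _∈ₛ?_)
open import Data.Fin.Subset.Induction using (⊂-wellFounded)
open import Data.Vec using (tabulate)
open import Data.Vec.Properties using (lookup∘tabulate; []=⇒lookup; lookup⇒[]=)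
open import Data.Bool using (true; false; _∧_; _∨_; not)
import Data.Bool as Bool
open import Data.List using (List; []; _∷_; _++_; [_]; map; length; initLast; _∷ʳ′_)
open import Data.List.Properties using (map-++; ++-assoc; ∷-injectiveˡ; ∷-injectiveʳ)
open import Data.List.Membership.Propositional using (_∈_)
open import Data.List.Membership.Propositional.Properties using (∈-∃++)
open import Data.List.Relation.Unary.All using (All; []; _∷_)
import Data.List.Relation.Unary.All as All
open import Data.List.Relation.Unary.All.Properties using (++⁺; ++⁻ʳ; ¬Any⇒All¬) renaming (map⁺ to All-map⁺)
import Data.List.Relation.Unary.Any as Any
open import Data.List.Relation.Unary.Unique.Propositional using (Unique; []; _∷_)
open import Data.List.Relation.Unary.Linked using (Linked; []; [-]; _∷_)
import Data.List.Relation.Unary.Linked as Linked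
open import Data.List.Relation.Unary.Linked.Properties using () renaming (map⁺ to Linked-map⁺)
open import Data.Product using (Σ; ∃; _×_; _,_; proj₁; proj₂)
import Data.Product as Product
open import Data.Sum using (_⊎_; inj₁; inj₂; [_,_]′)
import Data.Sum as Sum
open import Data.Unit using (⊤; tt)
open import Data.Empty using (⊥; ⊥-elim)
open import Function using (_∘_; id; case_of_)
open import Induction.WellFounded using (Acc; acc)
open import Relation.Nullary using (¬_; Dec; yes; no; does)
open import Relation.Nullary.Decidable using (⌊_⌋; map′; _×-dec_; _⊎-dec_; ¬?; dec-true)
open import Relation.Unary using (Decidable; _⊆_; _≐_; _∩_)
open import Relation.Unary.Properties using (≐-sym)
open import Relation.Binary.PropositionalEquality using (_≡_; _≢_; refl; sym; trans; cong; subst; ≢-sym; module ≡-Reasoning)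

-- Lists of the form xs ++ [ z ] describe paths by their last vertex.

module _ {A : Set} where

  linked-∷ʳ : ∀ {R : A → A → Set} {a l b} ys → Linked R (a ∷ ys ++ [ l ]) → R l b →
              Linked R (a ∷ (ys ++ [ l ]) ++ [ b ])
  linked-∷ʳ []       (r ∷ [-]) rb = r ∷ rb ∷ [-]
  linked-∷ʳ (_ ∷ ys) (r ∷ rs)  rb = r ∷ linked-∷ʳ ys rs rb

  linked-∷ʳ⁻ : ∀ {R : A → A → Set} {a l b} ys → Linked R (a ∷ (ys ++ [ l ]) ++ [ b ]) →
               Linked R (a ∷ ys ++ [ l ]) × R l b
  linked-∷ʳ⁻ []       (r ∷ rb ∷ [-]) = r ∷ [-] , rb
  linked-∷ʳ⁻ (_ ∷ ys) (r ∷ rs)       = Product.map₁ (r ∷_) (linked-∷ʳ⁻ ys rs)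

  linked-local : ∀ {P : A → Set} {R S : A → A → Set} → (∀ {a b} → P a → P b → R a b → S a b) →
                 ∀ {xs} → All P xs → Linked R xs → Linked S xs
  linked-local h []                  []       = []
  linked-local h (_ ∷ [])            [-]      = [-]
  linked-local h (pa ∷ ps@(pb ∷ _))  (r ∷ rs) = h pa pb r ∷ linked-local h ps rs

  unique-∷ʳ : ∀ {xs} {z : A} → Unique xs → All (_≢ z) xs → Unique (xs ++ [ z ])
  unique-∷ʳ []         []         = [] ∷ []
  unique-∷ʳ (x∉ ∷ uxs) (x≢ ∷ xs≢) = ++⁺ x∉ (x≢ ∷ []) ∷ unique-∷ʳ uxs xs≢

  all-last : ∀ {P : A → Set} xs {z} → All P (xs ++ [ z ]) → P z
  all-last xs pz with ++⁻ʳ xs pz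
  ... | p ∷ [] = p

  nonempty-∷ʳ : ∀ (xs : List A) z → 1 ≤ length (xs ++ [ z ])
  nonempty-∷ʳ []      z = s≤s z≤n
  nonempty-∷ʳ (_ ∷ _) z = s≤s z≤n

module _ {G : Graph} where
  open Graph G

  adj-sym : ∀ {a b} → Adj G a b → Adj G b a
  adj-sym {a} {b} e = trans (symm b a) e

  edge : ∀ {P a b} → P a → P b → Adj G a b → Walk G P a b
  edge pa pb e = step pa e (here pb)

  walk-start : ∀ {P a b} → Walk G P a b → P a
  walk-start (here p)     = p
  walk-start (step p _ _) = p

  walk-end : ∀ {P a b} → Walk G P a b → P b
  walk-end (here p)     = p
  walk-end (step _ _ w) = walk-end w

  _▸_ : ∀ {P a b c} → Walk G P a b → Walk G P b c → Walk G P a c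
  here _     ▸ w′ = w′
  step p e w ▸ w′ = step p e (w ▸ w′)

  walk-rev : ∀ {P a b} → Walk G P a b → Walk G P b a
  walk-rev (here p)     = here p
  walk-rev (step p e w) = walk-rev w ▸ edge (walk-start w) p (adj-sym e)

  via-hub : ∀ {P} h → (∀ a → P a → Walk G P a h) → Connected G P
  via-hub h to-hub a b pa pb = to-hub a pa ▸ walk-rev (to-hub b pb)

record Path (G : Graph) (P : Fin (Graph.n G) → Set) (xs : List (Fin (Graph.n G))) : Set where
  constructor path
  field
    inside   : All P xs
    distinct : Unique xs
    linked   : Linked (Adj G) xs

-- A cycle of G[P] cut open at its vertex x: a simple path x, y, zs…, l
-- of at least three vertices together with the closing edge lx.
record Loop (G : Graph) (P : Fin (Graph.n G) → Set) : Set where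
  constructor loop
  field
    x y     : Fin (Graph.n G)
    zs      : List (Fin (Graph.n G))
    l       : Fin (Graph.n G)
    route   : Path G P (x ∷ y ∷ zs ++ [ l ])
    closing : Adj G l x

vertices : ∀ {G P} → Loop G P → List (Fin (Graph.n G))
vertices (loop x y zs l _ _) = x ∷ y ∷ zs ++ [ l ]

module _ {G : Graph} {P : Fin (Graph.n G) → Set} where
  open Graph G

  loop→cycle : Loop G P → Cycle G P
  loop→cycle (loop x y zs l (path inside distinct linked) closing) = record
    { x = x ; xs = y ∷ zs ++ [ l ] ; long = s≤s (nonempty-∷ʳ zs l)
    ; inP = inside ; unique = distinct ; closed = linked-∷ʳ (y ∷ zs) linked closing }

  cycle→loop : Cycle G P → Loop G P
  cycle→loop record { xs = [] ; long = () }
  cycle→loop record { x = x ; xs = y ∷ xs ; long = s≤s long ; inP = inP ; unique = unique ; closed = closed }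
    with initLast xs
  ... | [] with long
  ...   | ()
  cycle→loop record { x = x ; xs = y ∷ _ ; inP = inP ; unique = unique ; closed = closed }
      | zs ∷ʳ′ l =
    let linked , closing = linked-∷ʳ⁻ (y ∷ zs) closed
    in  loop x y zs l (path inP unique linked) closing

  rotated : ∀ {x y l} zs → Path G P (x ∷ y ∷ zs ++ [ l ]) → Adj G l x →
            Path G P ((y ∷ zs ++ [ l ]) ++ [ x ])
  rotated zs (path (px ∷ ps) (x∉ ∷ distinct) (_ ∷ linked)) closing =
    path (++⁺ ps (px ∷ [])) (unique-∷ʳ distinct (All.map ≢-sym x∉)) (linked-∷ʳ zs linked closing)

  rotate : Loop G P → Loop G P
  rotate (loop x y []       l route closing) =
    loop y l [] x (rotated [] route closing) (Linked.head (Path.linked route))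
  rotate (loop x y (z ∷ zs) l route closing) =
    loop y z (zs ++ [ l ]) x (rotated (z ∷ zs) route closing) (Linked.head (Path.linked route))

  rotate-vertices : ∀ L → vertices (rotate L) ≡ (Loop.y L ∷ Loop.zs L ++ [ Loop.l L ]) ++ [ Loop.x L ]
  rotate-vertices (loop _ _ []      _ _ _) = refl
  rotate-vertices (loop _ _ (_ ∷ _) _ _ _) = refl

  rotate-ends : ∀ L → Loop.x (rotate L) ≡ Loop.y L × Loop.l (rotate L) ≡ Loop.x L
  rotate-ends (loop _ _ []      _ _ _) = refl , refl
  rotate-ends (loop _ _ (_ ∷ _) _ _ _) = refl , refl

  rotate-to : ∀ {z} (L : Loop G P) → z ∈ vertices L → Σ (Loop G P) λ L′ → Loop.x L′ ≡ z
  rotate-to L z∈ = let pre , post , eq = ∈-∃++ z∈ in go pre L eq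
    where
      open ≡-Reasoning
      go : ∀ pre {z post} (L : Loop G P) → vertices L ≡ pre ++ z ∷ post → Σ (Loop G P) λ L′ → Loop.x L′ ≡ z
      go []        L eq = L , ∷-injectiveˡ eq
      go (_ ∷ pre) {z} {post} L eq = go pre (rotate L) (begin
        vertices (rotate L)                          ≡⟨ rotate-vertices L ⟩
        (Loop.y L ∷ Loop.zs L ++ [ Loop.l L ]) ++ _  ≡⟨ cong (_++ [ Loop.x L ]) (∷-injectiveʳ eq) ⟩
        (pre ++ z ∷ post) ++ [ Loop.x L ]            ≡⟨ ++-assoc pre (z ∷ post) [ Loop.x L ] ⟩
        pre ++ z ∷ post ++ [ Loop.x L ]              ∎)

  refine : ∀ {Q} (L : Loop G P) → All Q (vertices L) → Loop G (P ∩ Q)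
  refine (loop x y zs l (path inside distinct linked) closing) qs =
    loop x y zs l (path (All.zip (inside , qs)) distinct linked) closing

module _ {G₁ G₂ : Graph} {P₁ : Fin (Graph.n G₁) → Set} {P₂ : Fin (Graph.n G₂) → Set}
         (f : Fin (Graph.n G₁) → Fin (Graph.n G₂)) (f-inside : ∀ {a} → P₁ a → P₂ (f a)) where

  mapWalk : (∀ {a b} → P₁ a → P₁ b → Adj G₁ a b → Walk G₂ P₂ (f a) (f b)) →
            ∀ {a b} → Walk G₁ P₁ a b → Walk G₂ P₂ (f a) (f b)
  mapWalk f-edge (here p)     = here (f-inside p)
  mapWalk f-edge (step p e w) = f-edge p (walk-start w) e ▸ mapWalk f-edge w

  module _ (f-injective : ∀ {a b} → P₁ a → P₁ b → f a ≡ f b → a ≡ b)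
           (f-adjacent  : ∀ {a b} → P₁ a → P₁ b → Adj G₁ a b → Adj G₂ (f a) (f b)) where

    mapPath : ∀ {xs} → Path G₁ P₁ xs → Path G₂ P₂ (map f xs)
    mapPath (path inside distinct linked) =
      path (All-map⁺ (All.map f-inside inside)) (unique-map inside distinct)
           (Linked-map⁺ (linked-local f-adjacent inside linked))
      where
        unique-map : ∀ {xs} → All P₁ xs → Unique xs → Unique (map f xs)
        unique-map []        []         = []
        unique-map (pa ∷ ps) (a∉ ∷ uxs) =
          All-map⁺ (All.zipWith (λ (pb , a≢b) → a≢b ∘ f-injective pa pb) (ps , a∉)) ∷ unique-map ps uxs

    mapLoop : Loop G₁ P₁ → Loop G₂ P₂
    mapLoop (loop x y zs l p closing) =
      loop (f x) (f y) (map f zs) (f l)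
           (subst (Path G₂ P₂) (cong (λ t → f x ∷ f y ∷ t) (map-++ f zs [ l ])) (mapPath p))
           (f-adjacent (all-last (y ∷ zs) (All.tail inside)) (All.head inside) closing)
      where open Path p

acyclic-from : ∀ {G G′ P P′} → (Loop G P → Loop G′ P′) → ¬ Cycle G′ P′ → ¬ Cycle G P
acyclic-from F acyclic′ C = acyclic′ (loop→cycle (F (cycle→loop C)))

module _ {G : Graph} where

  walk-mono : ∀ {P Q} → P ⊆ Q → ∀ {a b} → Walk G P a b → Walk G Q a b
  walk-mono P⊆Q = mapWalk id P⊆Q (λ pa pb e → edge (P⊆Q pa) (P⊆Q pb) e)

  loop-mono : ∀ {P Q} → P ⊆ Q → Loop G P → Loop G Q
  loop-mono P⊆Q = mapLoop id P⊆Q (λ _ _ eq → eq) (λ _ _ e → e)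

  tree-≐ : ∀ {P Q} → P ≐ Q → IsInducedTree G P → IsInducedTree G Q
  tree-≐ (P⊆Q , Q⊆P) ((a , pa) , connected , acyclic) =
    (a , P⊆Q pa) ,
    (λ a b qa qb → walk-mono P⊆Q (connected a b (Q⊆P qa) (Q⊆P qb))) ,
    acyclic-from (loop-mono Q⊆P) acyclic

module _ {G : Graph} where
  open Graph G

  last-exit : ∀ {p : Subset n} a {c b} → Walk G (_∈ₛ p) c b →
              a ≡ b ⊎ Walk G (_∈ₛ p - a) c b ⊎ ∃ λ c′ → Adj G a c′ × Walk G (_∈ₛ p - a) c′ b
  last-exit a (here {c} c∈p) with c ≟ a
  ... | yes refl = inj₁ refl
  ... | no c≢a   = inj₂ (inj₁ (here (x∈p∧x≢y⇒x∈p-y c∈p c≢a)))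
  last-exit a (step {c} {d} c∈p e w) with last-exit a w
  ... | inj₁ a≡b         = inj₁ a≡b
  ... | inj₂ (inj₂ exit) = inj₂ (inj₂ exit)
  ... | inj₂ (inj₁ w′) with c ≟ a
  ...   | yes refl = inj₂ (inj₂ (d , e , w′))
  ...   | no c≢a   = inj₂ (inj₁ (step (x∈p∧x≢y⇒x∈p-y c∈p c≢a) e w′))

  -- Well-founded recursion on the subset: a walk leaving a ≠ b continues
  -- from a neighbour of a inside the smaller set p - a.
  reach? : ∀ (p : Subset n) → Acc _⊂_ p → ∀ a b → Dec (Walk G (_∈ₛ p) a b)
  reach? p (acc smaller) a b with a ∈ₛ? p
  ... | no a∉p = no (a∉p ∘ walk-start)
  ... | yes a∈p with a ≟ b
  ...   | yes refl = yes (here a∈p)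
  ...   | no a≢b   = map′ enter leave
      (any? λ c → (adj a c Bool.≟ true) ×-dec reach? (p - a) (smaller (x∈p⇒p-x⊂p a∈p)) c b)
    where
      enter : (∃ λ c → Adj G a c × Walk G (_∈ₛ p - a) c b) → Walk G (_∈ₛ p) a b
      enter (c , e , w) = step a∈p e (walk-mono (p─q⊆p p ⁅ a ⁆) w)
      leave : Walk G (_∈ₛ p) a b → ∃ λ c → Adj G a c × Walk G (_∈ₛ p - a) c b
      leave (here _) = ⊥-elim (a≢b refl)
      leave (step {v = c} _ e w) with last-exit a w
      ... | inj₁ a≡b         = ⊥-elim (a≢b a≡b)
      ... | inj₂ (inj₁ w′)   = c , e , w′
      ... | inj₂ (inj₂ exit) = exit

  walk? : ∀ {P} → Decidable P → ∀ a b → Dec (Walk G P a b)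
  walk? {P} P? a b = map′ (walk-mono from-S) (walk-mono to-S) (reach? S (⊂-wellFounded S) a b)
    where
      S : Subset n
      S = tabulate (does ∘ P?)
      from-S : ∀ {x} → x ∈ₛ S → P x
      from-S {x} x∈S with P? x | trans (sym (lookup∘tabulate (does ∘ P?) x)) ([]=⇒lookup x∈S)
      ... | yes px | _ = px
      ... | no _   | ()
      to-S : ∀ {x} → P x → x ∈ₛ S
      to-S {x} px = lookup⇒[]= x S (trans (lookup∘tabulate (does ∘ P?) x) (dec-true (P? x) px))

module Separation {G : Graph} (R : Fin (Graph.n G) → Set) (R? : Decidable R)
                  (R-connected : Connected G R) {s t} (rs : R s) (rt : R t) (s≢t : s ≢ t) where
  open Graph G

  R-t : Fin n → Set
  R-t a = R a × a ≢ t

  Near : Fin n → Set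
  Near = Walk G R-t s

  Far : Fin n → Set
  Far a = R a × ¬ Near a

  near? : Decidable Near
  near? = walk? (λ a → R? a ×-dec ¬? (a ≟ t)) s

  near⊆R : Near ⊆ R
  near⊆R = proj₁ ∘ walk-end

  s-near : Near s
  s-near = here (rs , s≢t)

  t-far : Far t
  t-far = rt , λ w → proj₂ (walk-end w) refl

  -- every prefix of a walk from s inside R-t ends in Near
  near-walk : ∀ {a b} → Near a → Walk G R-t a b → Walk G Near a b
  near-walk na (here _)     = here na
  near-walk na (step _ e w) = step na e (near-walk (na ▸ edge (walk-end na) (walk-start w) e) w)

  near-connected : Connected G Near
  near-connected = via-hub s (λ a na → walk-rev (near-walk s-near na))

  -- a walk from a Far vertex to t never enters Near: a Far vertex other
  -- than t adjacent to a Near vertex would itself be Near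
  far-walk : ∀ {a} → ¬ Near a → Walk G R a t → Walk G Far a t
  far-walk {a} ¬na w with a ≟ t
  ... | yes refl = here (walk-start w , ¬na)
  ... | no a≢t with w
  ...   | here ra = here (ra , ¬na)
  ...   | step ra e w′ = step (ra , ¬na) e (far-walk ¬nb w′)
    where ¬nb = λ nb → ¬na (nb ▸ edge (walk-end nb) (ra , a≢t) (adj-sym {G} e))

  far-connected : Connected G Far
  far-connected = via-hub t (λ a (ra , ¬na) → far-walk ¬na (R-connected a t ra rt))

module _ {n m : ℕ} (c : Fin n → Fin m) where

  module Recolour (z j : Fin m) (unused : ∀ a → c a ≢ z) (z≢j : z ≢ j)
                  (A : Fin n → Set) (A? : Decidable A) (A⊆j : ∀ {a} → A a → c a ≡ j) where

    recolour : Fin n → Fin m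
    recolour a with A? a
    ... | yes _ = z
    ... | no _  = c a

    class-z : (λ a → recolour a ≡ z) ≐ A
    class-z = to , from
      where
        to : ∀ {a} → recolour a ≡ z → A a
        to {a} eq with A? a
        ... | yes aA = aA
        ... | no _   = ⊥-elim (unused a eq)
        from : ∀ {a} → A a → recolour a ≡ z
        from {a} aA with A? a
        ... | yes _  = refl
        ... | no ¬aA = ⊥-elim (¬aA aA)

    class-j : (λ a → recolour a ≡ j) ≐ (λ a → c a ≡ j × ¬ A a)
    class-j = to , from
      where
        to : ∀ {a} → recolour a ≡ j → c a ≡ j × ¬ A a
        to {a} eq with A? a
        ... | yes _  = ⊥-elim (z≢j eq)
        ... | no ¬aA = eq , ¬aA
        from : ∀ {a} → c a ≡ j × ¬ A a → recolour a ≡ j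
        from {a} (eq , ¬aA) with A? a
        ... | yes aA = ⊥-elim (¬aA aA)
        ... | no _   = eq

    class-other : ∀ {i} → i ≢ z → i ≢ j → (λ a → recolour a ≡ i) ≐ (λ a → c a ≡ i)
    class-other {i} i≢z i≢j = to , from
      where
        to : ∀ {a} → recolour a ≡ i → c a ≡ i
        to {a} eq with A? a
        ... | yes _ = ⊥-elim (i≢z (sym eq))
        ... | no _  = eq
        from : ∀ {a} → c a ≡ i → recolour a ≡ i
        from {a} eq with A? a
        ... | yes aA = ⊥-elim (i≢j (trans (sym eq) (A⊆j aA)))
        ... | no _   = eq

module _ {n m : ℕ} (c : Fin n → Fin (Nat.suc m)) (z : Fin (Nat.suc m)) (unused : ∀ a → c a ≢ z) where

  squeeze : Fin n → Fin m
  squeeze a = punchOut (unused a ∘ sym)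

  class-squeeze : ∀ i → (λ a → squeeze a ≡ i) ≐ (λ a → c a ≡ punchIn z i)
  class-squeeze i = (λ eq → trans (sym (punchIn-punchOut _)) (cong (punchIn z) eq))
                  , (λ eq → punchIn-injective z _ i (trans (punchIn-punchOut _) eq))

module _ {n : ℕ} where

  old new : (Fin n → Set) → Fin (Nat.suc n) → Set
  old R zero    = ⊥
  old R (suc a) = R a
  new R zero    = ⊤
  new R (suc a) = R a

  old-mono : ∀ {R R′} → R′ ⊆ R → old R′ ⊆ old R
  old-mono R′⊆R {suc a} ra = R′⊆R ra

  old⊆new : ∀ {R R′} → R′ ⊆ R → old R′ ⊆ new R
  old⊆new R′⊆R {suc a} ra = R′⊆R ra

  fresh-old : ∀ {R x} → new R x × zero ≢ x → old R x
  fresh-old {x = zero}  (_ , z≢z) = z≢z refl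
  fresh-old {x = suc a} (ra , _)  = ra

  module _ {m} (d : Fin (Nat.suc n) → Fin m) {i : Fin m} where

    class-new : d zero ≡ i → (λ x → d x ≡ i) ≐ new (λ a → d (suc a) ≡ i)
    class-new d0≡i = (λ { {zero} _ → tt ; {suc a} eq → eq }) , (λ { {zero} _ → d0≡i ; {suc a} eq → eq })

    class-old : d zero ≢ i → (λ x → d x ≡ i) ≐ old (λ a → d (suc a) ≡ i)
    class-old d0≢i = (λ { {zero} eq → d0≢i eq ; {suc a} eq → eq }) , (λ { {suc a} eq → eq })

module Subdivision (G : Graph) (u v : Fin (Graph.n G)) (e : Adj G u v) where
  open Graph G

  H : Graph
  H = subdivide G u v e

  UV : Fin n → Fin n → Set
  UV a b = (a ≡ u × b ≡ v) ⊎ (a ≡ v × b ≡ u)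

  End Inner : Fin n → Set
  End a   = a ≡ u ⊎ a ≡ v
  Inner a = a ≢ u × a ≢ v

  u≢v : u ≢ v
  u≢v refl = case trans (sym (irrefl u)) e of λ ()

  uv? : ∀ a b → Dec (UV a b)
  uv? a b = (a ≟ u ×-dec b ≟ v) ⊎-dec (a ≟ v ×-dec b ≟ u)

  uv-adj : ∀ {a b} → UV a b → Adj G a b
  uv-adj (inj₁ (refl , refl)) = e
  uv-adj (inj₂ (refl , refl)) = adj-sym {G} e

  uv-ends : ∀ {a b} → UV a b → End a × End b
  uv-ends (inj₁ (a≡u , b≡v)) = inj₁ a≡u , inj₂ b≡v
  uv-ends (inj₂ (a≡v , b≡u)) = inj₂ a≡v , inj₁ b≡u

  ends-uv : ∀ {a b} → End a → End b → a ≢ b → UV a b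
  ends-uv (inj₁ refl) (inj₁ refl) a≢b = ⊥-elim (a≢b refl)
  ends-uv (inj₁ a≡u)  (inj₂ b≡v)  _   = inj₁ (a≡u , b≡v)
  ends-uv (inj₂ a≡v)  (inj₁ b≡u)  _   = inj₂ (a≡v , b≡u)
  ends-uv (inj₂ refl) (inj₂ refl) a≢b = ⊥-elim (a≢b refl)

  inner-of : ∀ {a b y} → UV a b → y ≢ a → y ≢ b → Inner y
  inner-of (inj₁ (refl , refl)) y≢u y≢v = y≢u , y≢v
  inner-of (inj₂ (refl , refl)) y≢v y≢u = y≢u , y≢v

  avoid-end : ∀ {a b c} → End c → a ≢ c → b ≢ c → ¬ UV a b
  avoid-end (inj₁ refl) a≢u b≢u = [ a≢u ∘ proj₁ , b≢u ∘ proj₂ ]′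
  avoid-end (inj₂ refl) a≢v b≢v = [ b≢v ∘ proj₂ , a≢v ∘ proj₁ ]′

  inner-left : ∀ {a b} → Inner a → ¬ UV a b
  inner-left (a≢u , a≢v) = [ a≢u ∘ proj₁ , a≢v ∘ proj₁ ]′

  inner-right : ∀ {a b} → Inner b → ¬ UV a b
  inner-right (b≢u , b≢v) = [ b≢v ∘ proj₂ , b≢u ∘ proj₂ ]′

  no-uv : ∀ {R : Fin n → Set} {a b} → ¬ (R u × R v) → R a → R b → ¬ UV a b
  no-uv ¬both ra rb (inj₁ (refl , refl)) = ¬both (ra , rb)
  no-uv ¬both ra rb (inj₂ (refl , refl)) = ¬both (rb , ra)

  private
    ∨-split : ∀ x {y} → x ∨ y ≡ true → x ≡ true ⊎ y ≡ true
    ∨-split true  _ = inj₁ refl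
    ∨-split false h = inj₂ h

    ∧-split : ∀ x {y} → x ∧ y ≡ true → x ≡ true × y ≡ true
    ∧-split true h = refl , h

    ∧-intro : ∀ {x y} → x ≡ true → y ≡ true → x ∧ y ≡ true
    ∧-intro refl h = h

    ∨-introˡ : ∀ {x} y → x ≡ true → x ∨ y ≡ true
    ∨-introˡ _ refl = refl

    ∨-introʳ : ∀ x {y} → y ≡ true → x ∨ y ≡ true
    ∨-introʳ true  _ = refl
    ∨-introʳ false h = h

    ≟-sound : ∀ {a b : Fin n} → ⌊ a ≟ b ⌋ ≡ true → a ≡ b
    ≟-sound {a} {b} h with a ≟ b
    ... | yes a≡b = a≡b

    ≟-refl : ∀ {a : Fin n} → ⌊ a ≟ a ⌋ ≡ true
    ≟-refl {a} with a ≟ a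
    ... | yes _  = refl
    ... | no a≢a = ⊥-elim (a≢a refl)

    ≟-pair : ∀ {a b c d : Fin n} → ⌊ a ≟ b ⌋ ∧ ⌊ c ≟ d ⌋ ≡ true → a ≡ b × c ≡ d
    ≟-pair {a} {b} h = Product.map ≟-sound ≟-sound (∧-split ⌊ a ≟ b ⌋ h)

    isUV-sound : ∀ {a b} → isUV G u v a b ≡ true → UV a b
    isUV-sound {a} {b} h =
      Sum.map (≟-pair {a} {u} {b} {v}) (≟-pair {a} {v} {b} {u}) (∨-split (eq G u v a u ∧ eq G u v b v) h)

    isUV-complete : ∀ {a b} → UV a b → isUV G u v a b ≡ true
    isUV-complete (inj₁ (refl , refl)) = ∨-introˡ (eq G u v u v ∧ eq G u v v u) (∧-intro (≟-refl {u}) (≟-refl {v}))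
    isUV-complete (inj₂ (refl , refl)) = ∨-introʳ (eq G u v v u ∧ eq G u v u v) (∧-intro (≟-refl {v}) (≟-refl {u}))

  adj-w : ∀ {a} → Adj H zero (suc a) → End a
  adj-w {a} h = Sum.map ≟-sound ≟-sound (∨-split (eq G u v a u) h)

  adj-w⁻ : ∀ {a} → End a → Adj H zero (suc a)
  adj-w⁻ (inj₁ refl) = ∨-introˡ (eq G u v u v) (≟-refl {u})
  adj-w⁻ (inj₂ refl) = ∨-introʳ (eq G u v v u) (≟-refl {v})

  adj-keep : ∀ {a b} → ¬ UV a b → Adj G a b → Adj H (suc a) (suc b)
  adj-keep {a} {b} ¬uv eab = ∧-intro eab not-uv
    where
      not-uv : not (isUV G u v a b) ≡ true
      not-uv with isUV G u v a b in uv
      ... | false = refl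
      ... | true  = ⊥-elim (¬uv (isUV-sound uv))

  adj-drop : ∀ {a b} → Adj H (suc a) (suc b) → Adj G a b × ¬ UV a b
  adj-drop {a} {b} h =
    let eab , not-uv = ∧-split (adj a b) h
    in  eab , λ ab → case subst (λ t → not t ≡ true) (isUV-complete ab) not-uv of λ ()

  collapse : Fin n → Fin (Nat.suc n) → Fin n
  collapse r zero    = r
  collapse r (suc a) = a

  end-walk : ∀ {R : Fin n → Set} {a b} → R a → R b → End a → End b → Walk G R a b
  end-walk ra rb (inj₁ refl) (inj₁ refl) = here rb
  end-walk ra rb (inj₁ refl) (inj₂ refl) = edge ra rb e
  end-walk ra rb (inj₂ refl) (inj₁ refl) = edge ra rb (adj-sym {G} e)
  end-walk ra rb (inj₂ refl) (inj₂ refl) = here rb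

  module _ {R : Fin n → Set} where

    -- Walks.  Off w, every edge of H is an edge of G; an edge uv of G[R]
    -- is replaced by the walk u w v of H[new R]; if R contains an end r,
    -- the edges at w collapse onto walks from r.
    private
      old-inside : ∀ {x} → old R x → R (collapse u x)
      old-inside {suc a} ra = ra

      old-injective : ∀ {x y} → old R x → old R y → collapse u x ≡ collapse u y → x ≡ y
      old-injective {suc a} {suc b} _ _ = cong suc

      old-adjacent : ∀ {x y} → old R x → old R y → Adj H x y → Adj G (collapse u x) (collapse u y)
      old-adjacent {suc a} {suc b} _ _ = proj₁ ∘ adj-drop

    connected-old-down : Connected H (old R) → Connected G R
    connected-old-down connected a b ra rb =
      mapWalk (collapse u) (λ {x} → old-inside {x})
              (λ {x y} rx ry h → edge (old-inside {x} rx) (old-inside {y} ry) (old-adjacent {x} {y} rx ry h))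
              (connected (suc a) (suc b) ra rb)

    walk-old-up : ¬ (R u × R v) → ∀ {a b} → Walk G R a b → Walk H (old R) (suc a) (suc b)
    walk-old-up ¬both = mapWalk suc id (λ ra rb eab → edge ra rb (adj-keep (no-uv ¬both ra rb) eab))

    walk-new-up : ∀ {a b} → Walk G R a b → Walk H (new R) (suc a) (suc b)
    walk-new-up = mapWalk suc id edge-up
      where
        edge-up : ∀ {a b} → R a → R b → Adj G a b → Walk H (new R) (suc a) (suc b)
        edge-up {a} {b} ra rb eab with uv? a b
        ... | yes ab = let a-end , b-end = uv-ends ab
                       in  step ra (adj-w⁻ a-end) (edge {P = new R} {zero} tt rb (adj-w⁻ b-end))
        ... | no ¬ab = edge ra rb (adj-keep ¬ab eab)

    walk-new-down : ∀ {r} → R r → End r → ∀ {x y} → Walk H (new R) x y → Walk G R (collapse r x) (collapse r y)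
    walk-new-down {r} rr r-end = mapWalk (collapse r) (λ {x} → new-inside {x}) (λ {x y} → edge-down {x} {y})
      where
        new-inside : ∀ {x} → new R x → R (collapse r x)
        new-inside {zero}  _  = rr
        new-inside {suc a} ra = ra
        edge-down : ∀ {x y} → new R x → new R y → Adj H x y → Walk G R (collapse r x) (collapse r y)
        edge-down {zero}  {zero}  _  _  ()
        edge-down {zero}  {suc b} _  rb h = end-walk rr rb r-end (adj-w h)
        edge-down {suc a} {zero}  ra _  h = walk-rev (end-walk rr ra r-end (adj-w h))
        edge-down {suc a} {suc b} ra rb h = edge ra rb (proj₁ (adj-drop h))

    path-old-down : ∀ {xs} → Path H (old R) xs → Path G R (map (collapse u) xs)
    path-old-down = mapPath (collapse u) (λ {x} → old-inside {x}) (λ {x y} → old-injective {x} {y})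
                            (λ {x y} → old-adjacent {x} {y})

    loop-old-down : Loop H (old R) → Loop G R
    loop-old-down = mapLoop (collapse u) (λ {x} → old-inside {x}) (λ {x y} → old-injective {x} {y})
                            (λ {x y} → old-adjacent {x} {y})

    loop-old-up : ¬ (R u × R v) → Loop G R → Loop H (old R)
    loop-old-up ¬both = mapLoop suc id (λ _ _ → suc-injective) (λ ra rb → adj-keep (no-uv ¬both ra rb))

    -- A simple path of G[R] leaving an end a of uv through an inner vertex
    -- never uses the edge uv, so it is also a simple path of H.
    lift-path : ∀ {a y ys} → End a → Inner y → Path G R (a ∷ y ∷ ys) → Path H (new R) (map suc (a ∷ y ∷ ys))
    lift-path {a} {y} {ys} a-end y-inner (path (ra ∷ rs) (a∉ ∷ distinct) (eay ∷ linked)) =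
      path (ra ∷ inside) (All-map⁺ (All.map (_∘ suc-injective) a∉) ∷ distinct′)
           (adj-keep (inner-right y-inner) eay ∷ linked′)
      where
        lifted : Path H (new R) (map suc (y ∷ ys))
        lifted = mapPath {G₁ = G} {P₁ = R ∩ (a ≢_)} suc proj₁ (λ _ _ → suc-injective)
                   (λ (_ , a≢c) (_ , a≢d) → adj-keep (avoid-end a-end (≢-sym a≢c) (≢-sym a≢d)))
                   (path (All.zip (rs , a∉)) distinct linked)
        open Path lifted renaming (distinct to distinct′; linked to linked′)

  -- A detour of R: a simple path of G[R] from one end of uv to the other
  -- through at least one further vertex.  Closed by the edge uv it is a
  -- loop of G[R]; closed by w it is a loop of H[new R]; and every loop
  -- through w arises this way.
  record Detour (R : Fin n → Set) : Set where
    constructor detour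
    field
      p y   : Fin n
      ys    : List (Fin n)
      q     : Fin n
      ends  : UV p q
      route : Path G R (p ∷ y ∷ ys ++ [ q ])

  module _ {R : Fin n → Set} where

    loop→detour : (L : Loop G R) → UV (Loop.x L) (Loop.l L) → Detour R
    loop→detour (loop x y zs l route _) ends = detour x y zs l ends route

    detour→loop : Detour R → Loop G R
    detour→loop (detour p y ys q ends route) = loop p y ys q route (adj-sym {G} (uv-adj ends))

    detour→loop-via-w : Detour R → Loop H (new R)
    detour→loop-via-w (detour p y ys q ends route@(path _ (p∉ ∷ y∉ ∷ _) _)) =
      loop zero (suc p) (map suc (y ∷ ys)) (suc q)
           (subst (Path H (new R)) (cong (λ t → zero ∷ suc p ∷ t) (map-++ suc (y ∷ ys) [ q ]))
                  (path (tt ∷ inside) (All-map⁺ (All.universal (λ _ ()) _) ∷ distinct)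
                        (adj-w⁻ p-end ∷ linked)))
           (adj-w⁻ q-end)
      where
        p-end = proj₁ (uv-ends ends)
        q-end = proj₂ (uv-ends ends)
        open Path (lift-path p-end (inner-of ends (≢-sym (All.head p∉)) (all-last ys y∉)) route)

    -- Conversely a loop w, p, z, …, q of H[new R] has p, q the two ends,
    -- and z, … nonempty since the pair pq is not an edge of H.
    detour-at-w : (L : Loop H (new R)) → Loop.x L ≡ zero → Detour R
    detour-at-w (loop zero zero _ _ (path _ _ (() ∷ _)) _) refl
    detour-at-w (loop zero (suc p) _ zero _ ()) refl
    detour-at-w (loop zero (suc p) [] (suc q) (path _ (_ ∷ (sp≢sq ∷ []) ∷ _) (e₀ ∷ epq ∷ [-])) e₁) refl =
      ⊥-elim (proj₂ (adj-drop epq) (ends-uv (adj-w e₀) (adj-w e₁) (sp≢sq ∘ cong suc)))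
    detour-at-w (loop zero (suc p) (z ∷ zs) (suc q)
                      (path (_ ∷ inside) (w∉ ∷ distinct@(p∉ ∷ _)) (e₀ ∷ linked)) e₁) refl =
      detour p (collapse u z) (map (collapse u) zs) q
             (ends-uv (adj-w e₀) (adj-w e₁) (all-last (z ∷ zs) p∉ ∘ cong suc))
             (subst (Path G R) (cong (λ t → p ∷ collapse u z ∷ t) (map-++ (collapse u) zs [ suc q ]))
                    (path-old-down
                      (path (All.zipWith (λ {x} → fresh-old {x = x}) (inside , w∉)) distinct linked)))

    -- Loops of H[new R] give loops of G[R]: a loop avoiding w is old, a
    -- loop through w is a detour closed by w.
    loop-new-down : Loop H (new R) → Loop G R
    loop-new-down L with Any.any? (zero ≟_) (vertices L)
    ... | yes w∈ = let L′ , x≡w = rotate-to L w∈ in detour→loop (detour-at-w L′ x≡w)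
    ... | no w∉  = loop-old-down (loop-mono (λ {x} → fresh-old {x = x}) (refine L (¬Any⇒All¬ _ w∉)))

    -- Loops of G[R] give loops of H[new R].  Open the loop at u: if its
    -- first or last edge is uv it is a detour; otherwise it avoids uv.
    loop-at-u : (L : Loop G R) → Loop.x L ≡ u → Loop H (new R)
    loop-at-u L@(loop x y zs l route@(path _ (x∉ ∷ _) _) closing) x≡u with l ≟ v | y ≟ v
    ... | yes l≡v | _ = detour→loop-via-w (loop→detour L (inj₁ (x≡u , l≡v)))
    ... | no _ | yes y≡v =
      let x′≡y , l′≡x = rotate-ends L
      in  detour→loop-via-w (loop→detour (rotate L) (inj₂ (trans x′≡y y≡v , trans l′≡x x≡u)))
    ... | no l≢v | no y≢v =
      loop (suc x) (suc y) (map suc zs) (suc l)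
           (subst (Path H (new R)) (cong (λ t → suc x ∷ suc y ∷ t) (map-++ suc zs [ l ]))
                  (lift-path (inj₁ x≡u) (avoid-x (All.head x∉) , y≢v) route))
           (adj-keep (inner-left (avoid-x (all-last (y ∷ zs) x∉) , l≢v)) closing)
      where
        avoid-x : ∀ {c} → x ≢ c → c ≢ u
        avoid-x x≢c c≡u = x≢c (trans x≡u (sym c≡u))

    -- A loop avoiding u cannot use uv; one through u is opened at u.
    loop-new-up : Loop G R → Loop H (new R)
    loop-new-up L with Any.any? (u ≟_) (vertices L)
    ... | yes u∈ = let L′ , x≡u = rotate-to L u∈ in loop-at-u L′ x≡u
    ... | no u∉  = loop-mono (λ {x} → old⊆new proj₁ {x})
                     (loop-old-up (λ ((_ , u≢u) , _) → u≢u refl) (refine L (¬Any⇒All¬ _ u∉)))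

  module _ {R : Fin n → Set} where

    tree-old-up : ¬ (R u × R v) → IsInducedTree G R → IsInducedTree H (old R)
    tree-old-up ¬both ((a , ra) , connected , acyclic) =
      (suc a , ra) , connected′ , acyclic-from loop-old-down acyclic
      where
        connected′ : Connected H (old R)
        connected′ (suc a) (suc b) ra rb = walk-old-up ¬both (connected a b ra rb)

    tree-old-down : ¬ (R u × R v) → IsInducedTree H (old R) → IsInducedTree G R
    tree-old-down ¬both ((suc a , ra) , connected , acyclic) =
      (a , ra) , connected-old-down connected , acyclic-from (loop-old-up ¬both) acyclic

    tree-new-up : R u → IsInducedTree G R → IsInducedTree H (new R)
    tree-new-up ru (_ , connected , acyclic) =
      (zero , tt) , via-hub (suc u) to-u , acyclic-from loop-new-down acyclic
      where
        to-u : ∀ x → new R x → Walk H (new R) x (suc u)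
        to-u zero    _  = edge tt ru (adj-w⁻ (inj₁ refl))
        to-u (suc a) ra = walk-new-up (connected a u ra ru)

    tree-new-down : ∀ {r} → R r → End r → IsInducedTree H (new R) → IsInducedTree G R
    tree-new-down rr r-end (_ , connected , acyclic) =
      (_ , rr) , (λ a b ra rb → walk-new-down rr r-end (connected (suc a) (suc b) ra rb)) ,
      acyclic-from loop-new-up acyclic

  -- T(H) ≤ T(G): colour w like u.
  cover-up : ∀ {k} → HasTreeCover G k → HasTreeCover H k
  cover-up {k} (c , trees) = c⁺ , tree
    where
      c⁺ : Fin (Nat.suc n) → Fin k
      c⁺ zero    = c u
      c⁺ (suc a) = c a
      tree : ∀ i → IsInducedTree H (λ x → c⁺ x ≡ i)
      tree i with c u ≟ i
      ... | yes cu≡i = tree-≐ (≐-sym (class-new c⁺ cu≡i)) (tree-new-up cu≡i (trees i))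
      ... | no cu≢i  = tree-≐ (≐-sym (class-old c⁺ cu≢i)) (tree-old-up (cu≢i ∘ proj₁) (trees i))

  module _ {m} (d : Fin (Nat.suc n) → Fin (Nat.suc m))
           (trees : ∀ i → IsInducedTree H (λ x → d x ≡ i)) where

    -- If w shares its class with an end r, delete w.
    merge : ∀ {r} → End r → d zero ≡ d (suc r) → HasTreeCover G (Nat.suc m)
    merge {r} r-end w~r = (λ a → d (suc a)) , tree
      where
        tree : ∀ i → IsInducedTree G (λ a → d (suc a) ≡ i)
        tree i with d zero ≟ i
        ... | yes w≡i = tree-new-down (trans (sym w~r) w≡i) r-end (tree-≐ (class-new d w≡i) (trees i))
        ... | no w≢i  = tree-old-down ¬both (tree-≐ (class-old d w≢i) (trees i))
          where
            ¬both : ¬ (d (suc u) ≡ i × d (suc v) ≡ i)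
            ¬both (u≡i , v≡i) = w≢i (trans w~r ([ (λ { refl → u≡i }) , (λ { refl → v≡i }) ]′ r-end))

    -- Otherwise the class of w is {w}: its first step would reach u or v.
    alone : d zero ≢ d (suc u) → d zero ≢ d (suc v) → ∀ a → d (suc a) ≢ d zero
    alone w≁u w≁v a a~w with proj₁ (proj₂ (trees (d zero))) zero (suc a) refl a~w
    ... | step {v = zero}  _ () _
    ... | step {v = suc b} _ h walk with adj-w {b} h
    ...   | inj₁ refl = w≁u (sym (walk-start walk))
    ...   | inj₂ refl = w≁v (sym (walk-start walk))

    -- If u and v lie in different classes, drop the class {w}.
    drop : (∀ a → d (suc a) ≢ d zero) → d (suc u) ≢ d (suc v) → HasTreeCover G m
    drop lone u≁v = squeeze c (d zero) lone , tree
      where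
        c : Fin n → Fin (Nat.suc m)
        c a = d (suc a)
        tree : ∀ i → IsInducedTree G (λ a → squeeze c (d zero) lone a ≡ i)
        tree i = tree-≐ (≐-sym (class-squeeze c (d zero) lone i))
                   (tree-old-down (λ (u≡ , v≡) → u≁v (trans u≡ (sym v≡)))
                     (tree-≐ (class-old d (≢-sym (punchInᵢ≢i (d zero) i)))
                             (trees (punchIn (d zero) i))))

    -- If u and v lie in one class R, split R into the part reachable from
    -- u without passing v, recoloured with the colour of w, and the rest.
    split : (∀ a → d (suc a) ≢ d zero) → d (suc u) ≡ d (suc v) → HasTreeCover G (Nat.suc m)
    split lone u~v = recolour , tree
      where
        j = d (suc u)
        R : Fin n → Set
        R a = d (suc a) ≡ j
        R-tree : IsInducedTree H (old R)
        R-tree = tree-≐ (class-old d (lone u ∘ sym)) (trees j)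
        open Separation R (λ a → d (suc a) ≟ j) (connected-old-down (proj₁ (proj₂ R-tree)))
                        refl (sym u~v) u≢v
        open Recolour (λ a → d (suc a)) (d zero) j lone (lone u ∘ sym) Near near? near⊆R

        -- a connected part of R missing u or v is a tree: its cycles would
        -- be cycles of H[old R]
        part-tree : ∀ {A} → A ⊆ R → ¬ (A u × A v) → ∃ A → Connected G A → IsInducedTree G A
        part-tree A⊆R ¬both nonempty connected =
          nonempty , connected ,
          acyclic-from (loop-mono (λ {x} → old-mono A⊆R {x}) ∘ loop-old-up ¬both) (proj₂ (proj₂ R-tree))

        tree : ∀ i → IsInducedTree G (λ a → recolour a ≡ i)
        tree i with i ≟ d zero | i ≟ j
        ... | yes refl | _        =
          tree-≐ (≐-sym class-z) (part-tree near⊆R (λ (_ , near-v) → proj₂ t-far near-v) (_ , s-near) near-connected)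
        ... | no _     | yes refl =
          tree-≐ (≐-sym class-j) (part-tree proj₁ (λ ((_ , far-u) , _) → far-u s-near) (_ , t-far) far-connected)
        ... | no i≢z   | no i≢j   =
          tree-≐ (≐-sym (class-other i≢z i≢j))
                 (tree-old-down (λ (u≡i , _) → i≢j (sym u≡i)) (tree-≐ (class-old d (i≢z ∘ sym)) (trees i)))

  cover-down : ∀ {m} → HasTreeCover H m → Σ ℕ λ m′ → m′ ≤ m × HasTreeCover G m′
  cover-down {Nat.zero} (d , _) with d zero
  ... | ()
  cover-down {Nat.suc m} (d , trees)
    with d zero ≟ d (suc u) | d zero ≟ d (suc v) | d (suc u) ≟ d (suc v)
  ... | yes w~u | _       | _       = _ , ≤-refl , merge d trees (inj₁ refl) w~u
  ... | no _    | yes w~v | _       = _ , ≤-refl , merge d trees (inj₂ refl) w~v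
  ... | no w≁u  | no w≁v  | yes u~v = _ , ≤-refl , split d trees (alone d trees w≁u w≁v) u~v
  ... | no w≁u  | no w≁v  | no u≁v  = m , n≤1+n m , drop d trees (alone d trees w≁u w≁v) u≁v

theorem6p13 : (G : Graph) (u v : Fin (Graph.n G)) (e : Adj G u v) (k m : ℕ) →
    IsTreeCoverNumber G k → IsTreeCoverNumber (subdivide G u v e) m → k ≡ m
theorem6p13 G u v e k m (has-k , least-k) (has-m , least-m) with Subdivision.cover-down G u v e has-m
... | m′ , m′≤m , has-m′ =
  ≤-antisym (≤-trans (least-k m′ has-m′) m′≤m) (least-m k (Subdivision.cover-up G u v e has-k))
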